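{- Let $H$ be a generalized partial $n$-sun ($n\ge 3$). Then $Z(H) \le sdim(H)$.
   Context: A generalized partial $n$-sun is a graph obtained from the cycle $C_n$ by attaching to each vertex $v \in V(C_n)$ a finite (possibly zero, not necessarily equal across vertices) number of new leaves (pendant vertices). Zero forcing: color each vertex black or white, with $S$ the initial set of black vertices; the color-change rule turns a white vertex $u_2$ black if it is the only white neighbor of some black vertex. $S$ is a zero forcing set if repeated application eventually makes all vertices black; $Z(G)$ is the minimum size of a zero forcing set. A vertex $x$ strongly resolves $u,v$ if $u$ lies on some shortest $x$–$v$ path or $v$ lies on some shortest $x$–$u$ path; $W$ is a strong resolving set if every pair of distinct vertices is strongly resolved by some vertex of $W$; $sdim(G)$ is the minimum size of a strong resolving set. -}

module Defs where

open import Data.Nat using (ℕ; zero; suc; _+_; _∸_; _≤_)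
open import Data.Fin using (Fin; toℕ)
open import Data.Sum using (_⊎_; inj₁; inj₂)
open import Data.Product using (Σ; _×_; _,_; ∃)
open import Data.Empty using (⊥)
open import Data.List using (List)
open import Data.List.Membership.Propositional using (_∈_)
open import Relation.Binary.PropositionalEquality using (_≡_; _≢_)

-- The generalized partial n-sun determined by n and a leaf-count
-- function ℓ : vertex i of the cycle C_n (vertices Fin n, i ~ i+1 mod n)
-- receives ℓ i pendant leaves.
module Sun (n : ℕ) (ℓ : Fin n → ℕ) where

  V : Set
  V = Fin n ⊎ Σ (Fin n) (λ i → Fin (ℓ i))

  CycSucc : Fin n → Fin n → Set
  CycSucc i j = (toℕ j ≡ suc (toℕ i)) ⊎ (toℕ i ≡ n ∸ 1 × toℕ j ≡ 0)

  Adj : V → V → Set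
  Adj (inj₁ i) (inj₁ j) = CycSucc i j ⊎ CycSucc j i
  Adj (inj₁ i) (inj₂ (j , _)) = i ≡ j
  Adj (inj₂ (i , _)) (inj₁ j) = i ≡ j
  Adj (inj₂ _) (inj₂ _) = ⊥

  data Black (S : List V) : V → Set where
    initial : ∀ {v} → v ∈ S → Black S v
    force   : ∀ {u w} → Black S u → Adj u w →
              (∀ x → Adj u x → x ≢ w → Black S x) → Black S w

  ZeroForcing : List V → Set
  ZeroForcing S = ∀ v → Black S v

  data Walk : V → V → ℕ → Set where
    here : ∀ {x} → Walk x x 0
    step : ∀ {x y z k} → Adj x y → Walk y z k → Walk x z (suc k)

  OnShortestPath : V → V → V → Set
  OnShortestPath x u v =
    Σ ℕ λ a → Σ ℕ λ b → Walk x u a × Walk u v b ×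
      (∀ k → Walk x v k → a + b ≤ k)

  StronglyResolves : V → V → V → Set
  StronglyResolves x u v = OnShortestPath x u v ⊎ OnShortestPath x v u

  StrongResolving : List V → Set
  StrongResolving W = ∀ u v → u ≢ v → ∃ λ x → x ∈ W × StronglyResolves x u v

-- Resolving pairs of leaves forces a strong resolving set W to contain every leaf except at
-- most one, and resolving the two cycle neighbours of a vertex needs more than one vertex.
-- If no leaf is missing, trading one member of W for the cycle successor of another member's
-- hub gives two consecutive black cycle vertices. If the leaf at p is missing, its pair with
-- the antipode q = p + ⌊n/2⌋ can only be resolved from q; the antipodal pair next p, next q
-- is resolved from one of them. With next q we already have two consecutive black cycle
-- vertices; with next p we trade another member for the missing leaf, which makes p black.
-- Then forcing runs around the cycle in both directions, and the only vertex that may lack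
-- a black leaf finally forces it.
module Submission where

open import Data.Empty using (⊥-elim)
open import Data.Fin as Fin using (Fin; toℕ; fromℕ<)
open import Data.Fin.Properties using (toℕ-fromℕ<; fromℕ<-cong; toℕ-injective; toℕ<n; any?)
open import Data.List using (List; map; length)
open import Data.List.Properties using (length-map)
open import Data.List.Membership.Propositional using (_∈_; _∉_; find; lose)
open import Data.List.Membership.Propositional.Properties using (∈-map⁺)
import Data.List.Relation.Unary.Any as Any
open import Data.List.Relation.Unary.Unique.Propositional using (Unique)
open import Data.Nat
open import Data.Nat.DivMod
open import Data.Nat.Properties
open import Data.Product using (Σ; _×_; _,_; proj₁; proj₂)
import Data.Product.Properties as Σ
open import Data.Sum using (_⊎_; inj₁; inj₂)
import Data.Sum.Properties as ⊎
open import Function using (_∘_)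
open import Relation.Binary.Definitions using (DecidableEquality)
open import Relation.Binary.PropositionalEquality
open import Relation.Nullary using (¬_; ¬?; yes; no)
open import Relation.Nullary.Decidable using (decidable-stable)

open import Defs

module Cyclic (n : ℕ) .{{_ : NonZero n}} where

  infixl 6 _⊕_

  _⊕_ : Fin n → ℕ → Fin n
  i ⊕ k = (toℕ i + k) mod n

  next prev : Fin n → Fin n
  next i = i ⊕ 1
  prev i = i ⊕ (n ∸ 1)

  private
    [m%n+k]%n≡[m+k]%n : ∀ m k → (m % n + k) % n ≡ (m + k) % n
    [m%n+k]%n≡[m+k]%n m k = begin
      (m % n + k) % n           ≡⟨ %-distribˡ-+ (m % n) k n ⟩
      (m % n % n + k % n) % n   ≡⟨ cong (λ r → (r + k % n) % n) (m%n%n≡m%n m n) ⟩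
      (m % n + k % n) % n       ≡⟨ %-distribˡ-+ m k n ⟨
      (m + k) % n               ∎
      where open ≡-Reasoning

  toℕ-⊕ : ∀ i k → toℕ (i ⊕ k) ≡ (toℕ i + k) % n
  toℕ-⊕ i k = toℕ-fromℕ< (m%n<n (toℕ i + k) n)

  ⊕-≡ : ∀ i j {k m} → (toℕ i + k) % n ≡ (toℕ j + m) % n → i ⊕ k ≡ j ⊕ m
  ⊕-≡ i j {k} {m} e = fromℕ<-cong _ _ e (m%n<n (toℕ i + k) n) (m%n<n (toℕ j + m) n)

  ⊕-⊕ : ∀ i k m → i ⊕ k ⊕ m ≡ i ⊕ (k + m)
  ⊕-⊕ i k m = ⊕-≡ (i ⊕ k) i (begin
    (toℕ (i ⊕ k) + m) % n      ≡⟨ cong (λ r → (r + m) % n) (toℕ-⊕ i k) ⟩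
    ((toℕ i + k) % n + m) % n  ≡⟨ [m%n+k]%n≡[m+k]%n (toℕ i + k) m ⟩
    (toℕ i + k + m) % n        ≡⟨ cong (_% n) (+-assoc (toℕ i) k m) ⟩
    (toℕ i + (k + m)) % n      ∎)
    where open ≡-Reasoning

  ⊕-mod : ∀ i k → i ⊕ (k % n) ≡ i ⊕ k
  ⊕-mod i k = ⊕-≡ i i (begin
    (toℕ i + k % n) % n  ≡⟨ cong (_% n) (+-comm (toℕ i) (k % n)) ⟩
    (k % n + toℕ i) % n  ≡⟨ [m%n+k]%n≡[m+k]%n k (toℕ i) ⟩
    (k + toℕ i) % n      ≡⟨ cong (_% n) (+-comm k (toℕ i)) ⟩
    (toℕ i + k) % n      ∎)
    where open ≡-Reasoning

  ⊕-zero : ∀ i → i ⊕ 0 ≡ i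
  ⊕-zero i = toℕ-injective (begin
    toℕ (i ⊕ 0)     ≡⟨ toℕ-⊕ i 0 ⟩
    (toℕ i + 0) % n ≡⟨ cong (_% n) (+-identityʳ (toℕ i)) ⟩
    toℕ i % n       ≡⟨ m<n⇒m%n≡m (toℕ<n i) ⟩
    toℕ i           ∎)
    where open ≡-Reasoning

  ⊕-n : ∀ i → i ⊕ n ≡ i
  ⊕-n i = trans (sym (⊕-mod i n)) (trans (cong (i ⊕_) (n%n≡0 n)) (⊕-zero i))

  ⊕-suc : ∀ i k → i ⊕ suc k ≡ next (i ⊕ k)
  ⊕-suc i k = trans (cong (i ⊕_) (+-comm 1 k)) (sym (⊕-⊕ i k 1))

  next-⊕ : ∀ i k → next i ⊕ k ≡ i ⊕ suc k
  next-⊕ i k = ⊕-⊕ i 1 k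

  next-prev : ∀ i → next (prev i) ≡ i
  next-prev i = trans (sym (⊕-suc i (n ∸ 1))) (trans (cong (i ⊕_) (suc-pred n)) (⊕-n i))

  prev-next : ∀ i → prev (next i) ≡ i
  prev-next i = trans (next-⊕ i (n ∸ 1)) (trans (⊕-suc i (n ∸ 1)) (next-prev i))

  next-injective : ∀ {i j} → next i ≡ next j → i ≡ j
  next-injective {i} {j} e = trans (sym (prev-next i)) (trans (cong prev e) (prev-next j))

  toℕ-next : ∀ i → toℕ (next i) ≡ suc (toℕ i) % n
  toℕ-next i = trans (toℕ-⊕ i 1) (cong (_% n) (+-comm (toℕ i) 1))

  next≡⇒≡prev : ∀ {i j} → next i ≡ j → i ≡ prev j
  next≡⇒≡prev {i} refl = sym (prev-next i)

  -- offset i j is the unique k < n with i ⊕ k ≡ j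
  offset : Fin n → Fin n → ℕ
  offset i j = toℕ (j ⊕ (n ∸ toℕ i))

  private
    ∸-suc : ∀ {m o} → o < m → m ∸ o ≡ suc (m ∸ suc o)
    ∸-suc {suc m} {zero}  _         = refl
    ∸-suc {suc m} {suc o} (s≤s o<m) = ∸-suc o<m

    +-[n∸i] : ∀ (i : Fin n) k → toℕ i + (k + (n ∸ toℕ i)) ≡ k + n
    +-[n∸i] i k = begin
      toℕ i + (k + (n ∸ toℕ i)) ≡⟨ cong (toℕ i +_) (+-comm k _) ⟩
      toℕ i + ((n ∸ toℕ i) + k) ≡⟨ +-assoc (toℕ i) _ k ⟨
      toℕ i + (n ∸ toℕ i) + k   ≡⟨ cong (_+ k) (m+[n∸m]≡n (<⇒≤ (toℕ<n i))) ⟩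
      n + k                     ≡⟨ +-comm n k ⟩
      k + n                     ∎
      where open ≡-Reasoning

  offset<n : ∀ i j → offset i j < n
  offset<n i j = toℕ<n (j ⊕ (n ∸ toℕ i))

  ⊕-offset : ∀ i j → i ⊕ offset i j ≡ j
  ⊕-offset i j = begin
    i ⊕ toℕ (j ⊕ (n ∸ toℕ i))          ≡⟨ cong (i ⊕_) (toℕ-⊕ j _) ⟩
    i ⊕ ((toℕ j + (n ∸ toℕ i)) % n)    ≡⟨ ⊕-mod i _ ⟩
    i ⊕ (toℕ j + (n ∸ toℕ i))          ≡⟨ ⊕-≡ i j (cong (_% n) (+-[n∸i] i (toℕ j))) ⟩
    j ⊕ n                              ≡⟨ ⊕-n j ⟩
    j                                  ∎
    where open ≡-Reasoning

  offset-unique : ∀ {i j k} → k < n → i ⊕ k ≡ j → offset i j ≡ k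
  offset-unique {i} {k = k} k<n refl = begin
    toℕ (i ⊕ k ⊕ (n ∸ toℕ i))        ≡⟨ cong toℕ (⊕-⊕ i k _) ⟩
    toℕ (i ⊕ (k + (n ∸ toℕ i)))      ≡⟨ toℕ-⊕ i _ ⟩
    (toℕ i + (k + (n ∸ toℕ i))) % n  ≡⟨ cong (_% n) (+-[n∸i] i k) ⟩
    (k + n) % n                      ≡⟨ [m+n]%n≡m%n k n ⟩
    k % n                            ≡⟨ m<n⇒m%n≡m k<n ⟩
    k                                ∎
    where open ≡-Reasoning

  offset-self : ∀ i → offset i i ≡ 0
  offset-self i = offset-unique (>-nonZero⁻¹ n) (⊕-zero i)

  offset≡0⇒≡ : ∀ {i j} → offset i j ≡ 0 → i ≡ j
  offset≡0⇒≡ {i} {j} e = trans (sym (⊕-zero i)) (trans (cong (i ⊕_) (sym e)) (⊕-offset i j))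

  ⊕-≢ : ∀ i {k} → 0 < k → k < n → i ⊕ k ≢ i
  ⊕-≢ i 0<k k<n e = <-irrefl (trans (sym (offset-self i)) (offset-unique k<n e)) 0<k

  offset-next : ∀ i j → offset i (next j) ≡ suc (offset i j) % n
  offset-next i j = offset-unique (m%n<n _ n)
    (trans (⊕-mod i _) (trans (⊕-suc i _) (cong next (⊕-offset i j))))

  offset-next-next : ∀ i j → offset (next i) (next j) ≡ offset i j
  offset-next-next i j = offset-unique (offset<n i j)
    (trans (next-⊕ i _) (trans (⊕-suc i _) (cong next (⊕-offset i j))))

  offset+offset : ∀ {i j} → i ≢ j → offset i j + offset j i ≡ n
  offset+offset {i} {j} i≢j with offset i j in e
  ... | zero  = ⊥-elim (i≢j (offset≡0⇒≡ e))
  ... | suc o = trans (cong (suc o +_) back) (m+[n∸m]≡n (<⇒≤ o<n))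
    where
      o<n : suc o < n
      o<n = subst (_< n) e (offset<n i j)
      i⊕o≡j : i ⊕ suc o ≡ j
      i⊕o≡j = trans (cong (i ⊕_) (sym e)) (⊕-offset i j)
      back : offset j i ≡ n ∸ suc o
      back = offset-unique (∸-monoʳ-< z<s (<⇒≤ o<n)) (begin
        j ⊕ (n ∸ suc o)            ≡⟨ cong (_⊕ (n ∸ suc o)) i⊕o≡j ⟨
        i ⊕ suc o ⊕ (n ∸ suc o)    ≡⟨ ⊕-⊕ i (suc o) _ ⟩
        i ⊕ (suc o + (n ∸ suc o))  ≡⟨ cong (i ⊕_) (m+[n∸m]≡n (<⇒≤ o<n)) ⟩
        i ⊕ n                      ≡⟨ ⊕-n i ⟩
        i                          ∎)
        where open ≡-Reasoning

  -- the shorter of the two arcs into which offset o splits a cycle of length n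
  fold : ℕ → ℕ
  fold o = o ⊓ (n ∸ o)

  fold-step : ∀ {o} → o < n → fold o ≤ suc (fold (suc o % n)) × fold (suc o % n) ≤ suc (fold o)
  fold-step {o} o<n with suc o <? n
  ... | yes so<n rewrite m<n⇒m%n≡m so<n | ∸-suc o<n =
        ⊓-mono-≤ (m≤n+m _ 2) ≤-refl , ⊓-mono-≤ ≤-refl (m≤n+m _ 2)
  ... | no so≮n = ≤-trans (m⊓n≤n o (n ∸ o)) (≤-trans (≤-reflexive n∸o≡1) (s≤s z≤n))
                , ≤-trans (≤-reflexive (cong fold so%n≡0)) z≤n
    where
      so≡n : suc o ≡ n
      so≡n = ≤-antisym o<n (≮⇒≥ so≮n)
      n∸o≡1 : n ∸ o ≡ 1
      n∸o≡1 = trans (cong (_∸ o) (sym so≡n)) (m+n∸n≡m 1 o)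
      so%n≡0 : suc o % n ≡ 0
      so%n≡0 = trans (cong (_% n) so≡n) (n%n≡0 n)

  fold-∸ : ∀ {o} → o ≤ n → fold (n ∸ o) ≡ fold o
  fold-∸ {o} o≤n = trans (cong ((n ∸ o) ⊓_) (m∸[m∸n]≡n o≤n)) (⊓-comm (n ∸ o) o)

  dist : Fin n → Fin n → ℕ
  dist i j = fold (offset i j)

  dist-self : ∀ i → dist i i ≡ 0
  dist-self i = cong fold (offset-self i)

  dist-pos : ∀ {i j} → i ≢ j → 0 < dist i j
  dist-pos {i} {j} i≢j = ⊓-glb 0<o (m<n⇒0<n∸m (offset<n i j))
    where
      0<o : 0 < offset i j
      0<o = n≢0⇒n>0 (λ e → i≢j (offset≡0⇒≡ e))

  dist-next : ∀ i j → dist i j ≤ suc (dist i (next j)) × dist i (next j) ≤ suc (dist i j)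
  dist-next i j rewrite offset-next i j = fold-step (offset<n i j)

  dist-next-next : ∀ i j → dist (next i) (next j) ≡ dist i j
  dist-next-next i j = cong fold (offset-next-next i j)

  dist-sym : ∀ i j → dist i j ≡ dist j i
  dist-sym i j with i Fin.≟ j
  ... | yes refl = refl
  ... | no i≢j   = sym (trans (cong fold offset-ji) (fold-∸ (<⇒≤ (offset<n i j))))
    where
      offset-ji : offset j i ≡ n ∸ offset i j
      offset-ji = trans (sym (m+n∸m≡n (offset i j) _)) (cong (_∸ offset i j) (offset+offset i≢j))

  half : ℕ
  half = n / 2

  private
    half*2≡half+half : half * 2 ≡ half + half
    half*2≡half+half = trans (*-comm half 2) (cong (half +_) (+-identityʳ half))

  half+half≤n : half + half ≤ n
  half+half≤n = subst (_≤ n) half*2≡half+half (m/n*n≤m n 2)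

  n≤1+half+half : n ≤ suc (half + half)
  n≤1+half+half = begin
    n                     ≡⟨ m≡m%n+[m/n]*n n 2 ⟩
    n % 2 + half * 2      ≤⟨ +-mono-≤ (s≤s⁻¹ (m%n<n n 2)) (≤-reflexive half*2≡half+half) ⟩
    suc (half + half)     ∎
    where open ≤-Reasoning

  half≤n∸half : half ≤ n ∸ half
  half≤n∸half = m+n≤o⇒m≤o∸n half half+half≤n

  half<n : half < n
  half<n = m/n<m n 2 (s≤s (s≤s z≤n))

  half-pos : 2 ≤ n → 0 < half
  half-pos 2≤n = m≥n⇒m/n>0 2≤n

  dist-⊕-half : ∀ i → dist i (i ⊕ half) ≡ half
  dist-⊕-half i = trans (cong fold (offset-unique half<n refl)) (m≤n⇒m⊓n≡m half≤n∸half)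

  private
    n∸1<n : n ∸ 1 < n
    n∸1<n = ∸-monoʳ-< z<s (>-nonZero⁻¹ n)

  next≢ : 2 ≤ n → ∀ i → next i ≢ i
  next≢ 2≤n i = ⊕-≢ i z<s 2≤n

  prev≢ : 2 ≤ n → ∀ i → prev i ≢ i
  prev≢ 2≤n i = ⊕-≢ i (m<n⇒0<n∸m 2≤n) n∸1<n

  next≢prev : 3 ≤ n → ∀ i → next i ≢ prev i
  next≢prev 3≤n i e = <-irrefl 1≡n∸1 (∸-monoˡ-≤ 1 3≤n)
    where
      1≡n∸1 : 1 ≡ n ∸ 1
      1≡n∸1 = trans (sym (offset-unique (<⇒≤ 3≤n) e)) (offset-unique n∸1<n refl)

module SunGraph (n : ℕ) .{{_ : NonZero n}} (ℓ : Fin n → ℕ) where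
  open Cyclic n public
  open Sun n ℓ public

  Leaf : Set
  Leaf = Σ (Fin n) (λ i → Fin (ℓ i))

  cyc : Fin n → V
  cyc = inj₁

  hub : V → Fin n
  hub (inj₁ i)       = i
  hub (inj₂ (i , _)) = i

  depth : V → ℕ
  depth (inj₁ _) = 0
  depth (inj₂ _) = 1

  _≟ᵛ_ : DecidableEquality V
  _≟ᵛ_ = ⊎.≡-dec Fin._≟_ (Σ.≡-dec Fin._≟_ Fin._≟_)

  CycSucc-next : ∀ i → CycSucc i (next i)
  CycSucc-next i with suc (toℕ i) <? n
  ... | yes 1+i<n = inj₁ (trans (toℕ-next i) (m<n⇒m%n≡m 1+i<n))
  ... | no  1+i≮n = inj₂ (cong pred 1+i≡n , trans (toℕ-next i) (trans (cong (_% n) 1+i≡n) (n%n≡0 n)))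
    where
      1+i≡n : suc (toℕ i) ≡ n
      1+i≡n = ≤-antisym (toℕ<n i) (≮⇒≥ 1+i≮n)

  CycSucc⇒≡next : ∀ {i j} → CycSucc i j → j ≡ next i
  CycSucc⇒≡next {i} {j} (inj₁ j≡1+i) = toℕ-injective (begin
    toℕ j                ≡⟨ m<n⇒m%n≡m (toℕ<n j) ⟨
    toℕ j % n            ≡⟨ cong (_% n) j≡1+i ⟩
    suc (toℕ i) % n      ≡⟨ toℕ-next i ⟨
    toℕ (next i)         ∎)
    where open ≡-Reasoning
  CycSucc⇒≡next {i} {j} (inj₂ (i≡n-1 , j≡0)) = toℕ-injective (begin
    toℕ j                ≡⟨ j≡0 ⟩
    0                    ≡⟨ n%n≡0 n ⟨
    n % n                ≡⟨ cong (_% n) (trans (cong suc i≡n-1) (suc-pred n)) ⟨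
    suc (toℕ i) % n      ≡⟨ toℕ-next i ⟨
    toℕ (next i)         ∎)
    where open ≡-Reasoning

  adj-next : ∀ i → Adj (cyc i) (cyc (next i))
  adj-next i = inj₁ (CycSucc-next i)

  adj-prev : ∀ i → Adj (cyc i) (cyc (prev i))
  adj-prev i = subst (λ j → Adj (cyc j) (cyc (prev i))) (next-prev i) (inj₂ (CycSucc-next (prev i)))

  cycle-neighbour : ∀ {i j} → Adj (cyc i) (cyc j) → j ≡ next i ⊎ next j ≡ i
  cycle-neighbour (inj₁ i→j) = inj₁ (CycSucc⇒≡next i→j)
  cycle-neighbour (inj₂ j→i) = inj₂ (sym (CycSucc⇒≡next j→i))

  leaf-neighbour : ∀ {x} {y : Leaf} → Adj x (inj₂ y) → x ≡ cyc (proj₁ y)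
  leaf-neighbour {inj₁ _} refl = refl

  infixr 5 _++ʷ_

  _++ʷ_ : ∀ {x y z k m} → Walk x y k → Walk y z m → Walk x z (k + m)
  here     ++ʷ w′ = w′
  step a w ++ʷ w′ = step a (w ++ʷ w′)

  walk-⊕ : ∀ i k → Walk (cyc i) (cyc (i ⊕ k)) k
  walk-⊕ i zero    = subst (λ j → Walk (cyc i) (cyc j) 0) (sym (⊕-zero i)) here
  walk-⊕ i (suc k) = subst (λ j → Walk (cyc i) (cyc j) (suc k)) (next-⊕ i k)
                       (step (adj-next i) (walk-⊕ (next i) k))

  walk-⊕⁻ : ∀ i k → Walk (cyc (i ⊕ k)) (cyc i) k
  walk-⊕⁻ i zero    = subst (λ j → Walk (cyc j) (cyc i) 0) (sym (⊕-zero i)) here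
  walk-⊕⁻ i (suc k) = subst (λ j → Walk (cyc j) (cyc i) (suc k)) (sym (⊕-suc i k))
                        (step (inj₂ (CycSucc-next (i ⊕ k))) (walk-⊕⁻ i k))

  cycle-walk : ∀ i j → Σ ℕ λ k → k ≤ half × Walk (cyc i) (cyc j) k
  cycle-walk i j with i Fin.≟ j
  ... | yes refl = 0 , z≤n , here
  ... | no i≢j with offset i j ≤? half
  ...   | yes short = offset i j , short
                    , subst (λ v → Walk (cyc i) (cyc v) (offset i j)) (⊕-offset i j) (walk-⊕ i _)
  ...   | no long   = offset j i , short
                    , subst (λ v → Walk (cyc v) (cyc j) (offset j i)) (⊕-offset j i) (walk-⊕⁻ j _)
    where
      -- the two arcs have lengths summing to n ≤ 2 half + 1
      short : offset j i ≤ half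
      short = +-cancelˡ-≤ (suc half) _ _ (begin
        suc half + offset j i     ≤⟨ +-monoˡ-≤ (offset j i) (≰⇒> long) ⟩
        offset i j + offset j i   ≡⟨ offset+offset i≢j ⟩
        n                         ≤⟨ n≤1+half+half ⟩
        suc half + half           ∎)
        where open ≤-Reasoning

  walk-to-cycle : ∀ x j → Σ ℕ λ k → k ≤ depth x + half × Walk x (cyc j) k
  walk-to-cycle (inj₁ i)       j = cycle-walk i j
  walk-to-cycle (inj₂ (i , t)) j with cycle-walk i j
  ... | k , k≤half , w = suc k , s≤s k≤half , step refl w

  distTo : Fin n → V → ℕ
  distTo b v = depth v + dist b (hub v)

  distTo-adj : ∀ b {u w} → Adj u w → distTo b u ≤ suc (distTo b w)
  distTo-adj b {inj₁ i} {inj₁ j} a with cycle-neighbour a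
  ... | inj₁ refl = proj₁ (dist-next b i)
  ... | inj₂ refl = proj₂ (dist-next b j)
  distTo-adj b {inj₁ i} {inj₂ _} refl = m≤n+m _ 2
  distTo-adj b {inj₂ _} {inj₁ j} refl = ≤-refl

  distTo-walk : ∀ b {u k} → Walk u (cyc b) k → distTo b u ≤ k
  distTo-walk b here       = ≤-reflexive (dist-self b)
  distTo-walk b (step a w) = ≤-trans (distTo-adj b a) (s≤s (distTo-walk b w))

  distTo-pos : ∀ b x → hub x ≢ b → suc (depth x) ≤ distTo b x
  distTo-pos b x hub≢b = subst (_≤ distTo b x) (+-comm (depth x) 1)
                           (+-monoʳ-≤ (depth x) (dist-pos (λ e → hub≢b (sym e))))

  distTo≤depth⇒hub≡ : ∀ b x → distTo b x ≤ depth x → hub x ≡ b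
  distTo≤depth⇒hub≡ b x le with hub x Fin.≟ b
  ... | yes e     = e
  ... | no hub≢b = ⊥-elim (<-irrefl refl (≤-trans (distTo-pos b x hub≢b) le))

  walk-into-leaf : ∀ {x k} {y : Leaf} → Walk x (inj₂ y) k →
                   x ≡ inj₂ y ⊎ Σ ℕ λ k′ → k′ < k × Walk x (cyc (proj₁ y)) k′
  walk-into-leaf here = inj₁ refl
  walk-into-leaf (step a w) with walk-into-leaf w
  ... | inj₁ refl = inj₂ (0 , z<s , subst (λ u → Walk u (cyc _) 0) (sym (leaf-neighbour a)) here)
  ... | inj₂ (k′ , k′<k , w′) = inj₂ (suc k′ , s<s k′<k , step a w′)

  -- a shortest path through a leaf would enter and leave it through its hub
  leaf-¬OnShortestPath : ∀ {x v} {y : Leaf} → x ≢ inj₂ y → v ≢ inj₂ y → ¬ OnShortestPath x (inj₂ y) v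
  leaf-¬OnShortestPath x≢y v≢y (a , _ , w₁ , here , _) = v≢y refl
  leaf-¬OnShortestPath x≢y v≢y (a , suc b , w₁ , step {y = inj₁ _} refl w₂ , minimal)
    with walk-into-leaf w₁
  ... | inj₁ x≡y = x≢y x≡y
  ... | inj₂ (a′ , a′<a , w₁′) = ≤⇒≯ (minimal _ (w₁′ ++ʷ w₂)) (+-mono-<-≤ a′<a (n≤1+n b))

  dist-leaf-walk : ∀ p (t : Fin (ℓ p)) {i k} → Walk (cyc i) (inj₂ (p , t)) k → suc (dist p i) ≤ k
  dist-leaf-walk p t w with walk-into-leaf w
  ... | inj₂ (k′ , k′<k , w′) = ≤-trans (s≤s (distTo-walk p w′)) k′<k

  OnShortestPath⇒distTo+≤ : ∀ {x b v m K} → OnShortestPath x (cyc b) v → Walk x v K →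
                             (∀ {k} → Walk (cyc b) v k → m ≤ k) → distTo b x + m ≤ K
  OnShortestPath⇒distTo+≤ {b = b} (_ , _ , w₁ , w₂ , minimal) w bound =
    ≤-trans (+-mono-≤ (distTo-walk b w₁) (bound w₂)) (minimal _ w)

  far-OnShortestPath⇒hub≡ : ∀ {x i j} → half ≤ dist j i → OnShortestPath x (cyc i) (cyc j) → hub x ≡ i
  far-OnShortestPath⇒hub≡ {x} {i} {j} far sp with walk-to-cycle x j
  ... | K , K≤ , w = distTo≤depth⇒hub≡ i x
                       (+-cancelʳ-≤ half _ _ (≤-trans (OnShortestPath⇒distTo+≤ sp w bound) K≤))
    where
      bound : ∀ {k} → Walk (cyc i) (cyc j) k → half ≤ k
      bound w′ = ≤-trans far (distTo-walk j w′)

  far-leaf-OnShortestPath⇒hub≡ : ∀ {x p q} {t : Fin (ℓ p)} → half ≤ dist p q →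
                                 OnShortestPath x (cyc q) (inj₂ (p , t)) → hub x ≡ q
  far-leaf-OnShortestPath⇒hub≡ {x} {p} {q} {t} far sp with walk-to-cycle x p
  ... | K , K≤ , w = distTo≤depth⇒hub≡ q x
                       (+-cancelʳ-≤ (suc half) _ _
                         (≤-trans (OnShortestPath⇒distTo+≤ sp (w ++ʷ step refl here) bound) K+1≤))
    where
      bound : ∀ {k} → Walk (cyc q) (inj₂ (p , t)) k → suc half ≤ k
      bound w′ = ≤-trans (s≤s far) (dist-leaf-walk p t w′)
      K+1≤ : K + 1 ≤ depth x + suc half
      K+1≤ = ≤-trans (+-monoˡ-≤ 1 K≤)
               (≤-reflexive (trans (+-assoc (depth x) half 1) (cong (depth x +_) (+-comm half 1))))

  equidistant-¬OnShortestPath : ∀ {x u v K} → u ≢ v → Walk x v K → (∀ {k} → Walk x u k → K ≤ k) →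
                                ¬ OnShortestPath x u v
  equidistant-¬OnShortestPath u≢v _ _     (_ , _ , _ , here , _) = u≢v refl
  equidistant-¬OnShortestPath u≢v w bound (a , suc b , w₁ , step _ _ , minimal) =
    ≤⇒≯ (minimal _ w) (≤-<-trans (bound w₁) (m<m+n a z<s))

  walk-to-neighbour : ∀ x {b} → Adj (cyc (hub x)) (cyc b) → Walk x (cyc b) (suc (depth x))
  walk-to-neighbour (inj₁ _) a = step a here
  walk-to-neighbour (inj₂ _) a = step refl (step a here)

  -- both cycle neighbours of hub x are at distance 1 + depth x from x
  lone-resolver : 3 ≤ n → ∀ x → ¬ StronglyResolves x (cyc (next (hub x))) (cyc (prev (hub x)))
  lone-resolver 3≤n x (inj₁ sp) =
    equidistant-¬OnShortestPath (λ e → next≢prev 3≤n j (cong hub e)) (walk-to-neighbour x (adj-prev j))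
      (λ w → ≤-trans (distTo-pos (next j) x (λ e → next≢ (<⇒≤ 3≤n) j (sym e))) (distTo-walk _ w)) sp
    where
      j : Fin n
      j = hub x
  lone-resolver 3≤n x (inj₂ sp) =
    equidistant-¬OnShortestPath (λ e → next≢prev 3≤n j (sym (cong hub e))) (walk-to-neighbour x (adj-next j))
      (λ w → ≤-trans (distTo-pos (prev j) x (λ e → prev≢ (<⇒≤ 3≤n) j (sym e))) (distTo-walk _ w)) sp
    where
      j : Fin n
      j = hub x

  AllLeavesBut : List V → V → Set
  AllLeavesBut S x = ∀ y → inj₂ y ≢ x → inj₂ y ∈ S

  module _ {S : List V} where

    black-hub : ∀ {z i} → z ∈ S → hub z ≡ i → Black S (cyc i)
    black-hub {inj₁ _} z∈S refl = initial z∈S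
    black-hub {inj₂ _} z∈S refl = force (initial z∈S) refl λ { (inj₁ _) refl ne → ⊥-elim (ne refl) }

    force-next : ∀ {j} → Black S (cyc j) → (∀ t → inj₂ (j , t) ∈ S) →
                 Black S (cyc (prev j)) → Black S (cyc (next j))
    force-next {j} black-j leaves black-prev = force black-j (adj-next j) others
      where
        others : ∀ v → Adj (cyc j) v → v ≢ cyc (next j) → Black S v
        others (inj₁ i) a ne with cycle-neighbour a
        ... | inj₁ refl = ⊥-elim (ne refl)
        ... | inj₂ e    = subst (Black S ∘ cyc) (sym (next≡⇒≡prev e)) black-prev
        others (inj₂ (_ , t)) refl _ = initial (leaves t)

    force-prev : ∀ {j} → Black S (cyc j) → (∀ t → inj₂ (j , t) ∈ S) →
                 Black S (cyc (next j)) → Black S (cyc (prev j))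
    force-prev {j} black-j leaves black-next = force black-j (adj-prev j) others
      where
        others : ∀ v → Adj (cyc j) v → v ≢ cyc (prev j) → Black S v
        others (inj₁ i) a ne with cycle-neighbour a
        ... | inj₁ refl = black-next
        ... | inj₂ e    = ⊥-elim (ne (cong cyc (next≡⇒≡prev e)))
        others (inj₂ (_ , t)) refl _ = initial (leaves t)

  module _ {S : List V} {x : V} (allBut : AllLeavesBut S x)
           {a : Fin n} (black-a : Black S (cyc a)) (black-next-a : Black S (cyc (next a))) where

    -- Cycle vertices are indexed by their offset from p, the only hub that may keep a leaf outside S.
    private
      p : Fin n
      p = hub x

      B : ℕ → Set
      B k = Black S (cyc (p ⊕ k))

      m : ℕ
      m = offset p a

      B-m : B m
      B-m = subst (Black S ∘ cyc) (sym (⊕-offset p a)) black-a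

      B-1+m : B (suc m)
      B-1+m = subst (Black S ∘ cyc) (sym (trans (⊕-suc p m) (cong next (⊕-offset p a)))) black-next-a

      leaves-away : ∀ {k} → 0 < k → k < n → ∀ t → inj₂ (p ⊕ k , t) ∈ S
      leaves-away 0<k k<n t = allBut _ (λ e → ⊕-≢ p 0<k k<n (cong hub e))

      prev-⊕-suc : ∀ k → prev (p ⊕ suc k) ≡ p ⊕ k
      prev-⊕-suc k = trans (cong prev (⊕-suc p k)) (prev-next (p ⊕ k))

      step-up : ∀ k → suc k < n → B k → B (suc k) → B (suc (suc k))
      step-up k 1+k<n b b′ = subst (Black S ∘ cyc) (sym (⊕-suc p (suc k)))
        (force-next b′ (leaves-away z<s 1+k<n) (subst (Black S ∘ cyc) (sym (prev-⊕-suc k)) b))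

      step-down : ∀ k → suc k < n → B (suc k) → B (suc (suc k)) → B k
      step-down k 1+k<n b′ b″ = subst (Black S ∘ cyc) (prev-⊕-suc k)
        (force-prev b′ (leaves-away z<s 1+k<n) (subst (Black S ∘ cyc) (⊕-suc p (suc k)) b″))

      up : ∀ d → m + d < n → B (m + d) × B (suc (m + d))
      up zero    _ rewrite +-identityʳ m = B-m , B-1+m
      up (suc d) lt rewrite +-suc m d with up d (<⇒≤ lt)
      ... | b , b′ = b′ , step-up (m + d) lt b b′

      down : ∀ k d → k + d ≡ m → B k × B (suc k)
      down k zero    e = subst (λ j → B j × B (suc j)) (sym (trans (sym (+-identityʳ k)) e)) (B-m , B-1+m)
      down k (suc d) e with down (suc k) d (trans (sym (+-suc k d)) e)
      ... | b′ , b″ = step-down k 1+k<n b′ b″ , b′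
        where
          1+k<n : suc k < n
          1+k<n = begin-strict
            suc k         ≤⟨ s≤s (m≤m+n k d) ⟩
            suc (k + d)   ≡⟨ +-suc k d ⟨
            k + suc d     ≡⟨ e ⟩
            m             <⟨ offset<n p a ⟩
            n             ∎
            where open ≤-Reasoning

      reach : ∀ {k} → k < n → B k
      reach {k} k<n with ≤-total m k
      ... | inj₁ m≤k = subst B (m+[n∸m]≡n m≤k)
                         (proj₁ (up (k ∸ m) (subst (_< n) (sym (m+[n∸m]≡n m≤k)) k<n)))
      ... | inj₂ k≤m = proj₁ (down k (m ∸ k) (m+[n∸m]≡n k≤m))

    black-cycle : ∀ i → Black S (cyc i)
    black-cycle i = subst (Black S ∘ cyc) (⊕-offset p i) (reach (offset<n p i))

    zeroForcing : ZeroForcing S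
    zeroForcing (inj₁ i) = black-cycle i
    zeroForcing (inj₂ y) with inj₂ y ≟ᵛ x
    ... | no  y≢x  = initial (allBut y y≢x)
    ... | yes refl = force (black-cycle (proj₁ y)) refl others
      where
        others : ∀ v → Adj (cyc (proj₁ y)) v → v ≢ inj₂ y → Black S v
        others (inj₁ i) _    _   = black-cycle i
        others (inj₂ z) refl z≢y = initial (allBut z z≢y)

module Resolving (n : ℕ) .{{_ : NonZero n}} (3≤n : 3 ≤ n) (ℓ : Fin n → ℕ) where
  open SunGraph n ℓ
  open import Data.List.Membership.DecPropositional _≟ᵛ_ using (_∈?_)

  rename : V → V → V → V
  rename x y z with z ≟ᵛ x
  ... | yes _ = y
  ... | no  _ = z

  replace : V → V → List V → List V
  replace x y = map (rename x y)

  ∈-replace⁺ : ∀ {x y z W} → z ∈ W → z ≢ x → z ∈ replace x y W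
  ∈-replace⁺ {x} {y} {z} {W} z∈W z≢x = subst (_∈ replace x y W) rename-z (∈-map⁺ (rename x y) z∈W)
    where
      rename-z : rename x y z ≡ z
      rename-z with z ≟ᵛ x
      ... | yes z≡x = ⊥-elim (z≢x z≡x)
      ... | no  _   = refl

  ∈-replace-new : ∀ {x y W} → x ∈ W → y ∈ replace x y W
  ∈-replace-new {x} {y} {W} x∈W = subst (_∈ replace x y W) rename-x (∈-map⁺ (rename x y) x∈W)
    where
      rename-x : rename x y x ≡ y
      rename-x with x ≟ᵛ x
      ... | yes _   = refl
      ... | no  x≢x = ⊥-elim (x≢x refl)

  length-replace : ∀ {x y} W → length (replace x y W) ≡ length W
  length-replace {x} {y} W = length-map (rename x y) W

  module _ (W : List V) (resolving : StrongResolving W) where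

    AllLeavesBut-missing : ∀ {y} → inj₂ y ∉ W → AllLeavesBut W (inj₂ y)
    AllLeavesBut-missing {y} y∉W z z≢y with inj₂ z ∈? W
    ... | yes z∈W = z∈W
    ... | no  z∉W with resolving (inj₂ z) (inj₂ y) z≢y
    ...   | r , r∈W , inj₁ sp =
            ⊥-elim (leaf-¬OnShortestPath (λ e → z∉W (subst (_∈ W) e r∈W)) (z≢y ∘ sym) sp)
    ...   | r , r∈W , inj₂ sp =
            ⊥-elim (leaf-¬OnShortestPath (λ e → y∉W (subst (_∈ W) e r∈W)) z≢y sp)

    some-member : Σ V (_∈ W)
    some-member with resolving (cyc (next i₀)) (cyc i₀) (next≢ (<⇒≤ 3≤n) i₀ ∘ cong hub)
      where
        i₀ : Fin n
        i₀ = fromℕ< (>-nonZero⁻¹ n)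
    ... | x , x∈W , _ = x , x∈W

    another : ∀ y → Σ V λ x → x ∈ W × x ≢ y
    another y with Any.any? (λ x → ¬? (x ≟ᵛ y)) W
    ... | yes some = find some
    ... | no  none with resolving (cyc (next (hub y))) (cyc (prev (hub y))) (next≢prev 3≤n (hub y) ∘ cong hub)
    ...   | x , x∈W , resolves with x ≟ᵛ y
    ...     | yes refl = ⊥-elim (lone-resolver 3≤n x resolves)
    ...     | no  x≢y  = ⊥-elim (none (lose x∈W x≢y))

    occupied-antipode : ∀ {p t} → inj₂ (p , t) ∉ W → Σ V λ z → z ∈ W × hub z ≡ p ⊕ half
    occupied-antipode {p} {t} m∉W with resolving (inj₂ (p , t)) (cyc (p ⊕ half)) (λ ())
    ... | x , x∈W , inj₁ sp = ⊥-elim (leaf-¬OnShortestPath (λ e → m∉W (subst (_∈ W) e x∈W)) (λ ()) sp)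
    ... | x , x∈W , inj₂ sp = x , x∈W , far-leaf-OnShortestPath⇒hub≡ (≤-reflexive (sym (dist-⊕-half p))) sp

    occupied-far-pair : ∀ {i j} → i ≢ j → half ≤ dist i j → Σ V λ z → z ∈ W × (hub z ≡ i ⊎ hub z ≡ j)
    occupied-far-pair {i} {j} i≢j far with resolving (cyc i) (cyc j) (i≢j ∘ cong hub)
    ... | x , x∈W , inj₁ sp = x , x∈W , inj₁ (far-OnShortestPath⇒hub≡ (subst (half ≤_) (dist-sym i j) far) sp)
    ... | x , x∈W , inj₂ sp = x , x∈W , inj₂ (far-OnShortestPath⇒hub≡ far sp)

    SmallZeroForcingSet : Set
    SmallZeroForcingSet = Σ (List V) λ S → ZeroForcing S × length S ≤ length W

    all-leaves-case : (∀ y → inj₂ y ∈ W) → SmallZeroForcingSet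
    all-leaves-case leaves with some-member
    ... | y , y∈W with another y
    ...   | w , w∈W , w≢y =
            replace w (cyc (next (hub y))) W
          , zeroForcing (λ z z≢w → ∈-replace⁺ (leaves z) z≢w)
                        (black-hub (∈-replace⁺ y∈W (w≢y ∘ sym)) refl) (black-hub (∈-replace-new w∈W) refl)
          , ≤-reflexive (length-replace W)

    missing-leaf-case : ∀ p t → inj₂ (p , t) ∉ W → SmallZeroForcingSet
    missing-leaf-case p t m∉W with occupied-antipode m∉W | occupied-far-pair next-p≢next-q far
      where
        q : Fin n
        q = p ⊕ half
        next-p≢next-q : next p ≢ next q
        next-p≢next-q e = ⊕-≢ p (half-pos (<⇒≤ 3≤n)) half<n (sym (next-injective e))
        far : half ≤ dist (next p) (next q)
        far = ≤-reflexive (sym (trans (dist-next-next p q) (dist-⊕-half p)))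
    ... | z , z∈W , hub-z | z′ , z′∈W , inj₂ hub-z′ =
          W
        , zeroForcing (AllLeavesBut-missing m∉W) (black-hub z∈W hub-z) (black-hub z′∈W hub-z′)
        , ≤-refl
    ... | _ | z′ , z′∈W , inj₁ hub-z′ with another z′
    ...   | x , x∈W , x≢z′ =
            replace x m W
          , zeroForcing allBut (black-hub (∈-replace-new x∈W) refl)
                               (black-hub (∈-replace⁺ z′∈W (x≢z′ ∘ sym)) hub-z′)
          , ≤-reflexive (length-replace W)
      where
        m : V
        m = inj₂ (p , t)
        allBut : AllLeavesBut (replace x m W) x
        allBut y y≢x with inj₂ y ≟ᵛ m
        ... | yes refl = ∈-replace-new x∈W
        ... | no  y≢m  = ∈-replace⁺ (AllLeavesBut-missing m∉W y y≢m) y≢x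

    small-zero-forcing-set : SmallZeroForcingSet
    small-zero-forcing-set with any? (λ i → any? (λ t → ¬? (inj₂ (i , t) ∈? W)))
    ... | yes (p , t , m∉W) = missing-leaf-case p t m∉W
    ... | no  none          = all-leaves-case λ (i , t) →
                                decidable-stable (inj₂ (i , t) ∈? W) (λ m∉W → none (i , t , m∉W))

lemma3p10 : (n : ℕ) → 3 ≤ n → (ℓ : Fin n → ℕ) →
    (W : List (Sun.V n ℓ)) → Unique W → Sun.StrongResolving n ℓ W →
    Σ (List (Sun.V n ℓ)) (λ S → Sun.ZeroForcing n ℓ S × length S ≤ length W)
lemma3p10 n 3≤n ℓ W _ resolving =
  Resolving.small-zero-forcing-set n {{>-nonZero (≤-trans (s≤s z≤n) 3≤n)}} 3≤n ℓ W resolving
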